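{- Let $p\geq 2$ and let $G=(V,E)$ be a $2p$-regular graph on $n$ vertices. Then $G$ is $(p+2)$-star colourable if and only if $V$ can be partitioned into $(p+1)(p+2)$ sets $V_i^j$, indexed by $i,j\in\{0,1,\dots,p+1\}$ with $i\neq j$, such that for all such $i,j$, each vertex in $V_i^j$ has exactly $p$ neighbours in $\bigcup_{k\notin\{i,j\}} V_j^k$ and exactly one neighbour in $V_k^i$ for each $k\in\{0,1,\dots,p+1\}\setminus\{i,j\}$. Moreover, if $V$ can be partitioned into such sets $V_i^j$, then all sets $V_i^j$ have the same cardinality, and hence $n$ is divisible by $(p+1)(p+2)$.
   Context: All graphs are finite and simple. A $k$-colouring of $G$ is a map $f:V(G)\to\{0,\dots,k-1\}$ with $f(u)\neq f(v)$ for every edge $uv$; it is a $k$-star colouring if no path on 4 vertices in $G$ receives only two colours. $G$ is $k$-star colourable if it admits a $k$-star colouring. -}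

module Defs where

open import Data.Nat using (ℕ; _+_; _*_)
open import Data.Bool using (Bool; true; false; _∧_; not)
open import Data.Fin using (Fin; _≟_)
open import Data.List using (length; filterᵇ; allFin)
open import Data.Product using (Σ; _×_; _,_; proj₁; proj₂)
open import Relation.Nullary using (¬_; does)
open import Relation.Binary.PropositionalEquality using (_≡_; _≢_)

record Graph (n : ℕ) : Set where
  field
    adj   : Fin n → Fin n → Bool
    sym   : ∀ u v → adj u v ≡ adj v u
    irrefl : ∀ v → adj v v ≡ false

open Graph public

Edge : ∀ {n} → Graph n → Fin n → Fin n → Set
Edge G u v = adj G u v ≡ true

count : ∀ {n} → (Fin n → Bool) → ℕ
count {n} P = length (filterᵇ P (allFin n))

nbrCount : ∀ {n} → Graph n → Fin n → (Fin n → Bool) → ℕ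
nbrCount G v P = count (λ w → adj G v w ∧ P w)

degree : ∀ {n} → Graph n → Fin n → ℕ
degree G v = nbrCount G v (λ _ → true)

Regular : ∀ {n} → Graph n → ℕ → Set
Regular G d = ∀ v → degree G v ≡ d

IsColouring : ∀ {n} → Graph n → (k : ℕ) → (Fin n → Fin k) → Set
IsColouring G k f = ∀ u v → Edge G u v → f u ≢ f v

-- a path on 4 (distinct) vertices a-b-c-d receiving only two colours;
-- for a proper colouring this means f a ≡ f c and f b ≡ f d.
BicolouredP4 : ∀ {n k} → Graph n → (Fin n → Fin k) → Set
BicolouredP4 {n} G f =
  Σ (Fin n) λ a → Σ (Fin n) λ b → Σ (Fin n) λ c → Σ (Fin n) λ d →
    (a ≢ b × a ≢ c × a ≢ d × b ≢ c × b ≢ d × c ≢ d) ×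
    (Edge G a b × Edge G b c × Edge G c d) ×
    (f a ≡ f c × f b ≡ f d)

IsStarColouring : ∀ {n} → Graph n → (k : ℕ) → (Fin n → Fin k) → Set
IsStarColouring G k f = IsColouring G k f × ¬ BicolouredP4 G f

StarColourable : ∀ {n} → Graph n → ℕ → Set
StarColourable {n} G k = Σ (Fin n → Fin k) λ f → IsStarColouring G k f

-- A partition of V into sets V_i^j (i ≠ j, i,j ∈ {0..p+1}) is given by a
-- labelling of each vertex by its part (i , j) with i ≠ j.
Labelling : ℕ → ℕ → Set
Labelling p n = Σ (Fin n → Fin (p + 2) × Fin (p + 2))
                  λ L → ∀ v → proj₁ (L v) ≢ proj₂ (L v)

_==_ : ∀ {m} → Fin m → Fin m → Bool
x == y = does (x ≟ y)

inPart : ∀ {p n} → Labelling p n → Fin (p + 2) → Fin (p + 2) → Fin n → Bool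
inPart (L , _) a b w = (proj₁ (L w) == a) ∧ (proj₂ (L w) == b)

inUnion : ∀ {p n} → Labelling p n → Fin (p + 2) → Fin (p + 2) → Fin n → Bool
inUnion (L , _) i j w = (proj₁ (L w) == j) ∧ not (proj₂ (L w) == i) ∧ not (proj₂ (L w) == j)

partSize : ∀ {p n} → Labelling p n → Fin (p + 2) → Fin (p + 2) → ℕ
partSize P a b = count (inPart P a b)

GoodPartition : ∀ {p n} → Graph n → Labelling p n → Set
GoodPartition {p} G P =
  ∀ (i j : Fin (p + 2)) → i ≢ j → ∀ v → inPart P i j v ≡ true →
    nbrCount G v (inUnion P i j) ≡ p ×
    (∀ (k : Fin (p + 2)) → k ≢ i → k ≢ j → nbrCount G v (inPart P k i) ≡ 1)

HasGoodPartition : ∀ {n} → ℕ → Graph n → Set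
HasGoodPartition {n} p G = Σ (Labelling p n) λ P → GoodPartition G P

module Submission where

-- Let f be a star colouring of G with colours 0, …, p+1.  Call a neighbour w of v
-- lone if it is the only neighbour of v of colour f w.  The star condition says that
-- every edge has an end that is lone for the other end.  A vertex sees at most p+1
-- colours besides its own, and if all of them were lone its degree would be p+1 < 2p,
-- so each vertex has at most p lone neighbours.  As there are pn edges but at most pn
-- pairs (v, w) with w lone for v, every vertex has exactly p lone neighbours and every
-- edge exactly one lone end.  Hence every v has a unique second colour g v ≠ f v,
-- carrying its remaining p neighbours, and V_i^j = {v | f v = i, g v = j} is the
-- required partition.
--
-- Conversely, for v ∈ V_i^j the sets U = ⋃_{k∉{i,j}} V_j^k and B = ⋃_{k∉{i,j}} V_k^i
-- are disjoint and each contain p neighbours of v, so they contain all 2p of them.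
-- Colouring V_i^j by i is then proper, and a bicoloured path would give some vertex v
-- two neighbours in one part V_k^i.
--
-- Finally, double counting the edges between V_i^j and ⋃_{k∉{i,j}} V_j^k gives
-- p |V_i^j| + |V_j^i| = |⋃_k V_j^k| for all i ≠ j.  Summing these relations shows that
-- all the classes ⋃_k V_j^k have n / (p+2) elements, and then, as p ≥ 2, that all
-- the parts V_i^j have the same size.

open import Defs hiding (sym)
open import Data.Bool using (Bool; true; false; _∧_; _∨_; not)
open import Data.Bool.Properties using (∧-comm; ∧-assoc; ∧-zeroʳ; ∧-identityʳ; ∨-zeroʳ; ¬-not)
import Data.Bool.Properties as Bool
open import Data.Empty using (⊥-elim)
open import Data.Fin using (Fin; zero; suc; _≟_; _↑ʳ_)
open import Data.Fin.Properties using (any?; suc-injective; ↑ʳ-injective)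
open import Data.List using (length; filterᵇ; tabulate)
open import Data.Nat using (ℕ; zero; suc; _+_; _*_; _≤_; z≤n; s≤s; NonZero; >-nonZero)
open import Data.Nat.Divisibility using (_∣_; divides)
open import Data.Nat.Properties
  using ( +-*-semiring; +-commutativeSemigroup; +-comm; *-comm; +-identityʳ; *-identityʳ; *-zeroʳ
        ; +-cancelˡ-≡; +-cancelʳ-≡; *-cancelˡ-≡; +-cancelˡ-≤; +-cancelʳ-≤
        ; +-mono-≤; +-monoˡ-≤; +-monoʳ-≤; ≤-antisym; ≤-trans; ≤-refl; ≤-reflexive
        ; n≤0⇒n≡0; m≤n⇒m<n∨m≡n; m<1+n⇒m≤n; n≮n; ≤∧≢⇒<; m≤m+n; module ≤-Reasoning)
import Data.Nat.Properties as ℕ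
open import Algebra.Properties.CommutativeSemigroup +-commutativeSemigroup using (x∙yz≈y∙xz)
open import Algebra.Properties.Semiring.Sum +-*-semiring
  using (sum; sum-syntax; ∑-comm; ∑-distrib-+; sum-cong-≗; *-distribˡ-sum; *-distribʳ-sum; sum-replicate-zero)
open import Data.Nat.Tactic.RingSolver using (solve-∀)
open import Data.Product using (∃; _×_; _,_; proj₁; proj₂)
open import Data.Sum using (_⊎_; inj₁; inj₂)
open import Function using (_∘_; id)
open import Function.Bundles using (_⇔_; mk⇔)
open import Relation.Nullary using (Dec; yes; no; does; ¬_)
open import Relation.Nullary.Decidable using (dec-true; dec-false)
open import Relation.Binary.PropositionalEquality

𝟙 : Bool → ℕ
𝟙 true  = 1
𝟙 false = 0

𝟙-mono : ∀ {a b} → (a ≡ true → b ≡ true) → 𝟙 a ≤ 𝟙 b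
𝟙-mono {false} _   = z≤n
𝟙-mono {true}  a⇒b rewrite a⇒b refl = ≤-refl

∧≡true⇒ : ∀ {a b} → a ∧ b ≡ true → a ≡ true × b ≡ true
∧≡true⇒ {true} {true} _ = refl , refl

∨≡true⇒ : ∀ {a b} → a ∨ b ≡ true → a ≡ true ⊎ b ≡ true
∨≡true⇒ {true}  _ = inj₁ refl
∨≡true⇒ {false} b = inj₂ b

xor-from-∨-∧ : ∀ {a b} → a ∨ b ≡ true → a ∧ b ≡ false → b ≡ not a
xor-from-∨-∧ {true}  {false} _ _ = refl
xor-from-∨-∧ {false} {true}  _ _ = refl

does⇒ : ∀ {a} {A : Set a} (a? : Dec A) → does a? ≡ true → A
does⇒ (yes a) _ = a

==⇒≡ : ∀ {m} {x y : Fin m} → x == y ≡ true → x ≡ y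
==⇒≡ {x = x} {y} = does⇒ (x ≟ y)

==-refl : ∀ {m} (x : Fin m) → x == x ≡ true
==-refl x = dec-true (x ≟ x) refl

≢⇒==-false : ∀ {m} {x y : Fin m} → x ≢ y → x == y ≡ false
≢⇒==-false {x = x} {y} = dec-false (x ≟ y)

not-==⇒≢ : ∀ {m} {x y : Fin m} → not (x == y) ≡ true → x ≢ y
not-==⇒≢ {x = x} x≠y refl with () ← trans (sym (cong not (==-refl x))) x≠y

isOne : ℕ → Bool
isOne 1 = true
isOne _ = false

isOne⇒≡1 : ∀ {x} → isOne x ≡ true → x ≡ 1
isOne⇒≡1 {1} _ = refl

≢1⇒isOne-false : ∀ {x} → x ≢ 1 → isOne x ≡ false
≢1⇒isOne-false {0}           _   = refl
≢1⇒isOne-false {1}           x≢1 = ⊥-elim (x≢1 refl)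
≢1⇒isOne-false {suc (suc x)} _   = refl

isOne-decompose : ∀ x b → (b ≡ false → x ≡ 0) → x ≡ 𝟙 (isOne x) + 𝟙 (not (isOne x) ∧ b) * x
isOne-decompose 0             b     _     = sym (*-zeroʳ (𝟙 b))
isOne-decompose 1             b     _     = refl
isOne-decompose (suc (suc x)) true  _     = sym (+-identityʳ _)
isOne-decompose (suc (suc x)) false b⇒x≡0 with () ← b⇒x≡0 refl

skew-cancel : ∀ {p} → 2 ≤ p → ∀ x y → p * x + y ≡ p * y + x → x ≡ y
skew-cancel {suc zero} (s≤s ())
skew-cancel {suc (suc q)} _ x y eq =
  *-cancelˡ-≡ x y (suc q) (+-cancelʳ-≡ (x + y) _ _ (trans (shiftˡ q x y) (trans eq (sym (shiftʳ q x y)))))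
  where
    shiftˡ : ∀ q x y → suc q * x + (x + y) ≡ suc (suc q) * x + y
    shiftˡ = solve-∀
    shiftʳ : ∀ q x y → suc q * y + (x + y) ≡ suc (suc q) * y + x
    shiftʳ = solve-∀

squeeze : ∀ {a s y} → s ≤ a → (a + a) + y ≡ s + s → s ≡ a × y ≡ 0
squeeze {a} {s} {y} s≤a eq = ≤-antisym s≤a a≤s , n≤0⇒n≡0 y≤0
  where
    y≤0 : y ≤ 0
    y≤0 = +-cancelˡ-≤ (a + a) y 0
      (≤-trans (≤-reflexive eq) (≤-trans (+-mono-≤ s≤a s≤a) (≤-reflexive (sym (+-identityʳ (a + a))))))
    a≤s : a ≤ s
    a≤s = +-cancelʳ-≤ a a s (≤-trans (≤-trans (m≤m+n (a + a) y) (≤-reflexive eq)) (+-monoʳ-≤ s s≤a))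

∑-const : ∀ n c → ∑[ i < n ] c ≡ n * c
∑-const zero    c = refl
∑-const (suc n) c = cong (c +_) (∑-const n c)

∑-mono-≤ : ∀ {n} {f g : Fin n → ℕ} → (∀ i → f i ≤ g i) → sum f ≤ sum g
∑-mono-≤ {zero}  _   = z≤n
∑-mono-≤ {suc n} f≤g = +-mono-≤ (f≤g zero) (∑-mono-≤ (f≤g ∘ suc))

∑-mono-≤-tight : ∀ {n} {f g : Fin n → ℕ} → (∀ i → f i ≤ g i) → sum g ≤ sum f → ∀ i → f i ≡ g i
∑-mono-≤-tight {suc n} {f} {g} f≤g ∑g≤∑f zero =
  ≤-antisym (f≤g zero)
    (+-cancelʳ-≤ _ _ _ (≤-trans ∑g≤∑f (+-monoʳ-≤ (f zero) (∑-mono-≤ (f≤g ∘ suc)))))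
∑-mono-≤-tight {suc n} {f} {g} f≤g ∑g≤∑f (suc i) =
  ∑-mono-≤-tight (f≤g ∘ suc)
    (+-cancelˡ-≤ (g zero) _ _ (≤-trans ∑g≤∑f (+-monoˡ-≤ _ (f≤g zero)))) i

∑-cong-except : ∀ {m} {f g : Fin m → ℕ} j → (∀ i → i ≢ j → f i ≡ g i) → f j + sum g ≡ g j + sum f
∑-cong-except {suc m} {f} {g} zero f≗g =
  trans (cong (λ t → f zero + (g zero + t)) (sum-cong-≗ (λ i → sym (f≗g (suc i) λ ()))))
        (x∙yz≈y∙xz (f zero) (g zero) (sum (f ∘ suc)))
∑-cong-except {suc m} {f} {g} (suc j) f≗g = begin
  f (suc j) + (g zero + sum (g ∘ suc))
    ≡⟨ x∙yz≈y∙xz (f (suc j)) (g zero) _ ⟩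
  g zero + (f (suc j) + sum (g ∘ suc))
    ≡⟨ cong₂ _+_ (sym (f≗g zero λ ()))
                 (∑-cong-except j (λ i i≢j → f≗g (suc i) (i≢j ∘ suc-injective))) ⟩
  f zero + (g (suc j) + sum (f ∘ suc))
    ≡⟨ x∙yz≈y∙xz (f zero) (g (suc j)) _ ⟩
  g (suc j) + (f zero + sum (f ∘ suc)) ∎
  where open ≡-Reasoning

∑-𝟙-== : ∀ {m} (x : Fin m) → ∑[ k < m ] 𝟙 (x == k) ≡ 1
∑-𝟙-== {suc m} zero    = cong suc (sum-replicate-zero m)
∑-𝟙-== {suc m} (suc x) = ∑-𝟙-== x

length-filterᵇ-tabulate : ∀ {A : Set} {n} (P : A → Bool) (g : Fin n → A) →
  length (filterᵇ P (tabulate g)) ≡ ∑[ i < n ] 𝟙 (P (g i))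
length-filterᵇ-tabulate {n = zero}  P g = refl
length-filterᵇ-tabulate {n = suc n} P g with P (g zero)
... | true  = cong suc (length-filterᵇ-tabulate P (g ∘ suc))
... | false = length-filterᵇ-tabulate P (g ∘ suc)

module _ {n : ℕ} where

  count-≡-∑ : (P : Fin n → Bool) → count P ≡ ∑[ v < n ] 𝟙 (P v)
  count-≡-∑ P = length-filterᵇ-tabulate P id

  count-cong : ∀ {P Q : Fin n → Bool} → (∀ v → P v ≡ Q v) → count P ≡ count Q
  count-cong {P} {Q} P≗Q =
    trans (count-≡-∑ P) (trans (sum-cong-≗ (cong 𝟙 ∘ P≗Q)) (sym (count-≡-∑ Q)))

  count-false : count {n} (λ _ → false) ≡ 0
  count-false = trans (count-≡-∑ _) (sum-replicate-zero n)

  count-true : count {n} (λ _ → true) ≡ n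
  count-true = trans (count-≡-∑ _) (trans (∑-const n 1) (*-identityʳ n))

  count-== : (x : Fin n) → count (x ==_) ≡ 1
  count-== x = trans (count-≡-∑ _) (∑-𝟙-== x)

  count-mono : ∀ {P Q : Fin n → Bool} → (∀ v → P v ≡ true → Q v ≡ true) → count P ≤ count Q
  count-mono {P} {Q} P⊆Q =
    subst₂ _≤_ (sym (count-≡-∑ P)) (sym (count-≡-∑ Q)) (∑-mono-≤ (λ v → 𝟙-mono (P⊆Q v)))

  count-mono-tight : ∀ {P Q : Fin n → Bool} → (∀ v → P v ≡ true → Q v ≡ true) → count Q ≤ count P →
    ∀ v → Q v ≡ true → P v ≡ true
  count-mono-tight {P} {Q} P⊆Q #Q≤#P v Qv with P v in Pv
  ... | true  = refl
  ... | false with ∑-mono-≤-tight (λ v → 𝟙-mono (P⊆Q v)) (subst₂ _≤_ (count-≡-∑ Q) (count-≡-∑ P) #Q≤#P) v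
  ...   | 𝟙Pv≡𝟙Qv rewrite Pv | Qv with () ← 𝟙Pv≡𝟙Qv

  count-≡0 : ∀ {P : Fin n → Bool} → count P ≡ 0 → ∀ v → P v ≡ false
  count-≡0 {P} #P≡0 v with P v in Pv
  ... | false = refl
  ... | true with () ← count-mono-tight {P = λ _ → false} (λ _ ())
                         (subst (count P ≤_) (sym count-false) (≤-reflexive #P≡0)) v Pv

  count-split : ∀ (P Q : Fin n → Bool) → count P ≡ count (λ v → P v ∧ Q v) + count (λ v → P v ∧ not (Q v))
  count-split P Q = begin
    count P
      ≡⟨ count-≡-∑ P ⟩
    ∑[ v < n ] 𝟙 (P v)
      ≡⟨ sum-cong-≗ (λ v → split (P v) (Q v)) ⟩
    ∑[ v < n ] (𝟙 (P∧Q v) + 𝟙 (P∧¬Q v))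
      ≡⟨ ∑-distrib-+ (𝟙 ∘ P∧Q) (𝟙 ∘ P∧¬Q) ⟩
    ∑[ v < n ] 𝟙 (P∧Q v) + ∑[ v < n ] 𝟙 (P∧¬Q v)
      ≡⟨ cong₂ _+_ (count-≡-∑ P∧Q) (count-≡-∑ P∧¬Q) ⟨
    count P∧Q + count P∧¬Q ∎
    where
      open ≡-Reasoning
      P∧Q P∧¬Q : Fin n → Bool
      P∧Q v  = P v ∧ Q v
      P∧¬Q v = P v ∧ not (Q v)
      split : ∀ a b → 𝟙 a ≡ 𝟙 (a ∧ b) + 𝟙 (a ∧ not b)
      split false b     = refl
      split true  true  = refl
      split true  false = refl

  count-not : (P : Fin n → Bool) → count P + count (not ∘ P) ≡ n
  count-not P = trans (sym (count-split (λ _ → true) P)) count-true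

  count-inclusion-exclusion : ∀ (P Q R : Fin n → Bool) →
    count (λ v → P v ∧ (Q v ∨ R v)) + count (λ v → P v ∧ (Q v ∧ R v)) ≡
    count (λ v → P v ∧ Q v) + count (λ v → P v ∧ R v)
  count-inclusion-exclusion P Q R = begin
    count P∧[Q∨R] + count P∧[Q∧R]
      ≡⟨ cong₂ _+_ (count-≡-∑ P∧[Q∨R]) (count-≡-∑ P∧[Q∧R]) ⟩
    ∑[ v < n ] 𝟙 (P∧[Q∨R] v) + ∑[ v < n ] 𝟙 (P∧[Q∧R] v)
      ≡⟨ ∑-distrib-+ (𝟙 ∘ P∧[Q∨R]) (𝟙 ∘ P∧[Q∧R]) ⟨
    ∑[ v < n ] (𝟙 (P∧[Q∨R] v) + 𝟙 (P∧[Q∧R] v))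
      ≡⟨ sum-cong-≗ (λ v → pointwise (P v) (Q v) (R v)) ⟩
    ∑[ v < n ] (𝟙 (P∧Q v) + 𝟙 (P∧R v))
      ≡⟨ ∑-distrib-+ (𝟙 ∘ P∧Q) (𝟙 ∘ P∧R) ⟩
    ∑[ v < n ] 𝟙 (P∧Q v) + ∑[ v < n ] 𝟙 (P∧R v)
      ≡⟨ cong₂ _+_ (count-≡-∑ P∧Q) (count-≡-∑ P∧R) ⟨
    count P∧Q + count P∧R ∎
    where
      open ≡-Reasoning
      P∧[Q∨R] P∧[Q∧R] P∧Q P∧R : Fin n → Bool
      P∧[Q∨R] v = P v ∧ (Q v ∨ R v)
      P∧[Q∧R] v = P v ∧ (Q v ∧ R v)
      P∧Q v     = P v ∧ Q v
      P∧R v     = P v ∧ R v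
      pointwise : ∀ a b c → 𝟙 (a ∧ (b ∨ c)) + 𝟙 (a ∧ (b ∧ c)) ≡ 𝟙 (a ∧ b) + 𝟙 (a ∧ c)
      pointwise false b     c = refl
      pointwise true  true  c = refl
      pointwise true  false c = +-identityʳ (𝟙 c)

  count-pair : ∀ {x y : Fin n} → x ≢ y → count (λ v → x == v ∨ y == v) ≡ 2
  count-pair {x} {y} x≢y = begin
    count x∨y
      ≡⟨ +-identityʳ _ ⟨
    count x∨y + 0
      ≡⟨ cong (count x∨y +_) disjoint ⟨
    count x∨y + count x∧y
      ≡⟨ count-inclusion-exclusion (λ _ → true) (x ==_) (y ==_) ⟩
    count (x ==_) + count (y ==_)
      ≡⟨ cong₂ _+_ (count-== x) (count-== y) ⟩
    2 ∎
    where
      open ≡-Reasoning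
      x∨y x∧y : Fin n → Bool
      x∨y v = x == v ∨ y == v
      x∧y v = x == v ∧ y == v
      pointwise : ∀ v → x∧y v ≡ false
      pointwise v with x ≟ v
      ... | yes refl = ≢⇒==-false (x≢y ∘ sym)
      ... | no _     = refl
      disjoint : count x∧y ≡ 0
      disjoint = trans (count-cong pointwise) count-false

  count-others₁ : (x : Fin n) → 1 + count (λ k → not (x == k)) ≡ n
  count-others₁ x = trans (cong (_+ count (λ k → not (x == k))) (sym (count-== x))) (count-not (x ==_))

  count-others₂ : ∀ {x y : Fin n} → x ≢ y → 2 + count (λ k → not (x == k ∨ y == k)) ≡ n
  count-others₂ {x} {y} x≢y =
    trans (cong (_+ count (λ k → not (x == k ∨ y == k))) (sym (count-pair x≢y))) (count-not (λ k → x == k ∨ y == k))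

  count-≡1-unique : ∀ {P : Fin n → Bool} → count P ≡ 1 → ∀ {x y} → P x ≡ true → P y ≡ true → x ≡ y
  count-≡1-unique {P} #P≡1 {x} {y} Px Py with x ≟ y
  ... | yes x≡y = x≡y
  ... | no  x≢y = ⊥-elim (n≮n 1 (subst (2 ≤_) #P≡1 (subst (_≤ count P) (count-pair x≢y) (count-mono pair⊆P))))
    where
      pair⊆P : ∀ v → (x == v ∨ y == v) ≡ true → P v ≡ true
      pair⊆P v _  with x ≟ v | y ≟ v
      pair⊆P v _  | yes refl | _        = Px
      pair⊆P v _  | no _     | yes refl = Py
      pair⊆P v () | no _     | no _

  count-witness : ∀ {P : Fin n → Bool} → 1 ≤ count P → ∃ λ v → P v ≡ true
  count-witness {P} 1≤#P with any? (λ v → P v Bool.≟ true)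
  ... | yes witness = witness
  ... | no  none with () ← subst (1 ≤_) (trans (count-cong (λ v → ¬-not (λ Pv → none (v , Pv)))) count-false) 1≤#P

  count-another : ∀ {P : Fin n → Bool} → 2 ≤ count P → ∀ x → ∃ λ y → y ≢ x × P y ≡ true
  count-another {P} 2≤#P x = y , not-==⇒≢ (proj₂ Py∧x≢y) ∘ sym , proj₁ Py∧x≢y
    where
      P∖x : Fin n → Bool
      P∖x y = P y ∧ not (x == y)
      1≤#P∖x : 1 ≤ count P∖x
      1≤#P∖x = +-cancelˡ-≤ 1 _ _ (begin
        2
          ≤⟨ 2≤#P ⟩
        count P
          ≡⟨ count-split P (x ==_) ⟩
        count (λ y → P y ∧ x == y) + count P∖x
          ≤⟨ +-monoˡ-≤ _ (count-mono (λ y → proj₂ ∘ ∧≡true⇒)) ⟩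
        count (x ==_) + count P∖x
          ≡⟨ cong (_+ count P∖x) (count-== x) ⟩
        1 + count P∖x ∎)
        where open ≤-Reasoning
      y = proj₁ (count-witness 1≤#P∖x)
      Py∧x≢y = ∧≡true⇒ (proj₂ (count-witness 1≤#P∖x))

  count-fibres : ∀ {m} (P : Fin n → Bool) (g : Fin n → Fin m) →
    count P ≡ ∑[ k < m ] count (λ v → P v ∧ g v == k)
  count-fibres {m} P g = begin
    count P
      ≡⟨ count-≡-∑ P ⟩
    ∑[ v < n ] 𝟙 (P v)
      ≡⟨ sum-cong-≗ (λ v → fibre (P v) (g v)) ⟨
    ∑[ v < n ] ∑[ k < m ] 𝟙 (P v ∧ g v == k)
      ≡⟨ ∑-comm (λ v k → 𝟙 (P v ∧ g v == k)) ⟩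
    ∑[ k < m ] ∑[ v < n ] 𝟙 (P v ∧ g v == k)
      ≡⟨ sum-cong-≗ (λ k → count-≡-∑ (λ v → P v ∧ g v == k)) ⟨
    ∑[ k < m ] count (λ v → P v ∧ g v == k) ∎
    where
      open ≡-Reasoning
      fibre : ∀ b x → ∑[ k < m ] 𝟙 (b ∧ x == k) ≡ 𝟙 b
      fibre true  x = ∑-𝟙-== x
      fibre false x = sum-replicate-zero m

  ∑-𝟙-* : ∀ {P : Fin n → Bool} {g : Fin n → ℕ} {c} → (∀ v → P v ≡ true → g v ≡ c) →
    ∑[ v < n ] (𝟙 (P v) * g v) ≡ count P * c
  ∑-𝟙-* {P} {g} {c} P⇒g≡c = begin
    ∑[ v < n ] (𝟙 (P v) * g v)
      ≡⟨ sum-cong-≗ pointwise ⟩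
    ∑[ v < n ] (𝟙 (P v) * c)
      ≡⟨ *-distribʳ-sum c (𝟙 ∘ P) ⟨
    (∑[ v < n ] 𝟙 (P v)) * c
      ≡⟨ cong (_* c) (count-≡-∑ P) ⟨
    count P * c ∎
    where
      open ≡-Reasoning
      pointwise : ∀ v → 𝟙 (P v) * g v ≡ 𝟙 (P v) * c
      pointwise v with P v in Pv
      ... | true  = cong (_+ 0) (P⇒g≡c v Pv)
      ... | false = refl

module _ {n : ℕ} (G : Graph n) where

  Edge-sym : ∀ {u v} → Edge G u v → Edge G v u
  Edge-sym {u} {v} e = trans (Graph.sym G v u) e

  nbrCount-cong : ∀ {v} {Q R : Fin n → Bool} → (∀ w → Edge G v w → Q w ≡ R w) →
    nbrCount G v Q ≡ nbrCount G v R
  nbrCount-cong {v} {Q} {R} Q≗R = count-cong pointwise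
    where
      pointwise : ∀ w → adj G v w ∧ Q w ≡ adj G v w ∧ R w
      pointwise w with adj G v w in e
      ... | false = refl
      ... | true  = Q≗R w e

  nbrCount-∧-const : ∀ v b (Q : Fin n → Bool) → nbrCount G v (λ w → b ∧ Q w) ≡ 𝟙 b * nbrCount G v Q
  nbrCount-∧-const v true  Q = sym (+-identityʳ _)
  nbrCount-∧-const v false Q = trans (count-cong (λ w → ∧-zeroʳ (adj G v w))) (count-false {n})

  nbrCount-fibres : ∀ {m} v (Q : Fin n → Bool) (g : Fin n → Fin m) →
    nbrCount G v Q ≡ ∑[ k < m ] nbrCount G v (λ w → Q w ∧ g w == k)
  nbrCount-fibres v Q g = trans (count-fibres (λ w → adj G v w ∧ Q w) g)
    (sum-cong-≗ (λ k → count-cong (λ w → ∧-assoc (adj G v w) (Q w) (g w == k))))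

  ∑-nbrCount-swap : (R : Fin n → Fin n → Bool) →
    ∑[ v < n ] nbrCount G v (R v) ≡ ∑[ w < n ] nbrCount G w (λ v → R v w)
  ∑-nbrCount-swap R = begin
    ∑[ v < n ] nbrCount G v (R v)
      ≡⟨ sum-cong-≗ (λ v → count-≡-∑ (λ w → adj G v w ∧ R v w)) ⟩
    ∑[ v < n ] ∑[ w < n ] 𝟙 (adj G v w ∧ R v w)
      ≡⟨ ∑-comm (λ v w → 𝟙 (adj G v w ∧ R v w)) ⟩
    ∑[ w < n ] ∑[ v < n ] 𝟙 (adj G v w ∧ R v w)
      ≡⟨ sum-cong-≗ (λ w → sum-cong-≗ (λ v → cong (λ b → 𝟙 (b ∧ R v w)) (Graph.sym G v w))) ⟩
    ∑[ w < n ] ∑[ v < n ] 𝟙 (adj G w v ∧ R v w)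
      ≡⟨ sum-cong-≗ (λ w → count-≡-∑ (λ v → adj G w v ∧ R v w)) ⟨
    ∑[ w < n ] nbrCount G w (λ v → R v w) ∎
    where open ≡-Reasoning

  double-counting : ∀ {P Q : Fin n → Bool} {c d} →
    (∀ v → P v ≡ true → nbrCount G v Q ≡ c) → (∀ w → Q w ≡ true → nbrCount G w P ≡ d) →
    count P * c ≡ count Q * d
  double-counting {P} {Q} {c} {d} P⇒c Q⇒d = begin
    count P * c
      ≡⟨ ∑-𝟙-* P⇒c ⟨
    ∑[ v < n ] (𝟙 (P v) * nbrCount G v Q)
      ≡⟨ sum-cong-≗ (λ v → nbrCount-∧-const v (P v) Q) ⟨
    ∑[ v < n ] nbrCount G v (λ w → P v ∧ Q w)
      ≡⟨ ∑-nbrCount-swap (λ v w → P v ∧ Q w) ⟩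
    ∑[ w < n ] nbrCount G w (λ v → P v ∧ Q w)
      ≡⟨ sum-cong-≗ (λ w → count-cong (λ v → cong (adj G w v ∧_) (∧-comm (P v) (Q w)))) ⟩
    ∑[ w < n ] nbrCount G w (λ v → Q w ∧ P v)
      ≡⟨ sum-cong-≗ (λ w → nbrCount-∧-const w (Q w) P) ⟩
    ∑[ w < n ] (𝟙 (Q w) * nbrCount G w P)
      ≡⟨ ∑-𝟙-* Q⇒d ⟩
    count Q * d ∎
    where open ≡-Reasoning

module PartitionFromStarColouring {p n : ℕ} (p≥2 : 2 ≤ p) (G : Graph n) (regular : Regular G (2 * p))
  (f : Fin n → Fin (p + 2)) (star : IsStarColouring G (p + 2) f) where

  p≢1 : p ≢ 1
  p≢1 refl = n≮n 1 p≥2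

  proper : IsColouring G (p + 2) f
  proper = proj₁ star

  d : Fin n → Fin (p + 2) → ℕ
  d v c = nbrCount G v (λ w → f w == c)

  single : Fin n → Fin (p + 2) → Bool
  single v c = isOne (d v c)

  Lone : Fin n → Fin n → Bool
  Lone v w = single v (f w)

  d-own : ∀ v → d v (f v) ≡ 0
  d-own v = trans (count-cong pointwise) (count-false {n})
    where
      pointwise : ∀ w → adj G v w ∧ (f w == f v) ≡ false
      pointwise w with adj G v w in e
      ... | false = refl
      ... | true  = ≢⇒==-false (proper v w e ∘ sym)

  ∑-d : ∀ v → ∑[ c < p + 2 ] d v c ≡ 2 * p
  ∑-d v = trans (sym (nbrCount-fibres G v (λ _ → true) f)) (regular v)

  1≤d-neighbour : ∀ {v w} → Edge G v w → 1 ≤ d v (f w)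
  1≤d-neighbour {v} {w} e = subst (_≤ d v (f w)) (count-== w) (count-mono w-counted)
    where
      w-counted : ∀ u → w == u ≡ true → adj G v u ∧ (f u == f w) ≡ true
      w-counted u w==u with ==⇒≡ {x = w} {u} w==u
      ... | refl rewrite e = ==-refl (f w)

  another-neighbour : ∀ {v c} → 2 ≤ d v c → ∀ w → ∃ λ w′ → w′ ≢ w × Edge G v w′ × f w′ ≡ c
  another-neighbour 2≤d w with count-another 2≤d w
  ... | w′ , w′≢w , h with ∧≡true⇒ h
  ...   | e , fw′==c = w′ , w′≢w , e , ==⇒≡ fw′==c

  bicoloured-P4 : ∀ {v w v′ w′} → Edge G v w → Edge G v w′ → Edge G w v′ → w′ ≢ w → v′ ≢ v →
    f w′ ≡ f w → f v′ ≡ f v → BicolouredP4 G f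
  bicoloured-P4 {v} {w} {v′} {w′} vw vw′ wv′ w′≢w v′≢v fw′≡fw fv′≡fv =
    v′ , w , v , w′ , (v′≢w , v′≢v , v′≢w′ , w≢v , w′≢w ∘ sym , v≢w′) ,
    (Edge-sym G wv′ , Edge-sym G vw , vw′) , (fv′≡fv , sym fw′≡fw)
    where
      fv≢fw = proper v w vw
      v′≢w : v′ ≢ w
      v′≢w refl = fv≢fw (sym fv′≡fv)
      v′≢w′ : v′ ≢ w′
      v′≢w′ refl = fv≢fw (trans (sym fv′≡fv) fw′≡fw)
      w≢v : w ≢ v
      w≢v refl = fv≢fw refl
      v≢w′ : v ≢ w′
      v≢w′ refl = fv≢fw fw′≡fw

  lone-end : ∀ {v w} → Edge G v w → Lone v w ∨ Lone w v ≡ true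
  lone-end {v} {w} e with d v (f w) ℕ.≟ 1 | d w (f v) ℕ.≟ 1
  ... | yes dvw≡1 | _         = cong (λ x → isOne x ∨ Lone w v) dvw≡1
  ... | no _      | yes dwv≡1 = trans (cong (λ x → Lone v w ∨ isOne x) dwv≡1) (∨-zeroʳ (Lone v w))
  ... | no dvw≢1 | no dwv≢1
    with another-neighbour (≤∧≢⇒< (1≤d-neighbour e) (dvw≢1 ∘ sym)) w
       | another-neighbour (≤∧≢⇒< (1≤d-neighbour (Edge-sym G e)) (dwv≢1 ∘ sym)) v
  ... | w′ , w′≢w , vw′ , fw′≡fw | v′ , v′≢v , wv′ , fv′≡fv =
    ⊥-elim (proj₂ star (bicoloured-P4 e vw′ wv′ w′≢w v′≢v fw′≡fw fv′≡fv))

  singles : Fin n → ℕ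
  singles v = count (single v)

  other-colours : ∀ v → count (λ c → not (f v == c)) ≡ suc p
  other-colours v = ℕ.suc-injective (trans (count-others₁ (f v)) (+-comm p 2))

  single⇒other : ∀ v c → single v c ≡ true → not (f v == c) ≡ true
  single⇒other v c h with f v ≟ c
  ... | yes refl with () ← trans (sym (cong isOne (d-own v))) h
  ... | no _     = refl

  singles≤p : ∀ v → singles v ≤ p
  singles≤p v with m≤n⇒m<n∨m≡n (subst (singles v ≤_) (other-colours v) (count-mono (single⇒other v)))
  ... | inj₁ singles<1+p = m<1+n⇒m≤n singles<1+p
  ... | inj₂ singles≡1+p = ⊥-elim (p≢1 (+-cancelʳ-≡ p p 1 (begin
    p + p
      ≡⟨ cong (p +_) (+-identityʳ p) ⟨
    2 * p
      ≡⟨ ∑-d v ⟨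
    ∑[ c < p + 2 ] d v c
      ≡⟨ sum-cong-≗ d≡𝟙 ⟩
    ∑[ c < p + 2 ] 𝟙 (not (f v == c))
      ≡⟨ count-≡-∑ (λ c → not (f v == c)) ⟨
    count (λ c → not (f v == c))
      ≡⟨ other-colours v ⟩
    1 + p ∎)))
    where
      open ≡-Reasoning
      all-single : ∀ c → not (f v == c) ≡ true → single v c ≡ true
      all-single = count-mono-tight (single⇒other v) (≤-reflexive (trans (other-colours v) (sym singles≡1+p)))
      d≡𝟙 : ∀ c → d v c ≡ 𝟙 (not (f v == c))
      d≡𝟙 c with f v ≟ c
      ... | yes refl = d-own v
      ... | no fv≢c  = isOne⇒≡1 (all-single c (cong not (≢⇒==-false fv≢c)))

  singles-as-nbrCount : ∀ v → nbrCount G v (Lone v) ≡ singles v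
  singles-as-nbrCount v = begin
    nbrCount G v (Lone v)
      ≡⟨ nbrCount-fibres G v (Lone v) f ⟩
    ∑[ c < p + 2 ] nbrCount G v (λ w → Lone v w ∧ f w == c)
      ≡⟨ sum-cong-≗ (λ c → count-cong (λ w → cong (adj G v w ∧_) (fibre c w))) ⟩
    ∑[ c < p + 2 ] nbrCount G v (λ w → single v c ∧ f w == c)
      ≡⟨ sum-cong-≗ (λ c → nbrCount-∧-const G v (single v c) (λ w → f w == c)) ⟩
    ∑[ c < p + 2 ] (𝟙 (single v c) * d v c)
      ≡⟨ ∑-𝟙-* {P = single v} {g = d v} (λ c → isOne⇒≡1) ⟩
    singles v * 1
      ≡⟨ *-identityʳ (singles v) ⟩
    singles v ∎
    where
      open ≡-Reasoning
      fibre : ∀ c w → Lone v w ∧ f w == c ≡ single v c ∧ f w == c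
      fibre c w with f w ≟ c
      ... | yes refl = refl
      ... | no _     = trans (∧-zeroʳ (Lone v w)) (sym (∧-zeroʳ (single v c)))

  both-lone : Fin n → ℕ
  both-lone v = nbrCount G v (λ w → Lone v w ∧ Lone w v)

  incidences-at : ∀ v → 2 * p + both-lone v ≡ singles v + nbrCount G v (λ w → Lone w v)
  incidences-at v = begin
    2 * p + both-lone v
      ≡⟨ cong (_+ both-lone v) every-neighbour ⟨
    nbrCount G v (λ w → Lone v w ∨ Lone w v) + both-lone v
      ≡⟨ count-inclusion-exclusion (adj G v) (Lone v) (λ w → Lone w v) ⟩
    nbrCount G v (Lone v) + nbrCount G v (λ w → Lone w v)
      ≡⟨ cong (_+ nbrCount G v (λ w → Lone w v)) (singles-as-nbrCount v) ⟩
    singles v + nbrCount G v (λ w → Lone w v) ∎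
    where
      open ≡-Reasoning
      every-neighbour : nbrCount G v (λ w → Lone v w ∨ Lone w v) ≡ 2 * p
      every-neighbour = trans (nbrCount-cong G (λ w → lone-end)) (regular v)

  incidences : (n * p + n * p) + ∑[ v < n ] both-lone v ≡ ∑[ v < n ] singles v + ∑[ v < n ] singles v
  incidences = begin
    (n * p + n * p) + ∑[ v < n ] both-lone v
      ≡⟨ cong (_+ ∑[ v < n ] both-lone v) (trans (∑-const n (2 * p)) (double n p)) ⟨
    ∑[ v < n ] (2 * p) + ∑[ v < n ] both-lone v
      ≡⟨ ∑-distrib-+ (λ _ → 2 * p) both-lone ⟨
    ∑[ v < n ] (2 * p + both-lone v)
      ≡⟨ sum-cong-≗ incidences-at ⟩
    ∑[ v < n ] (singles v + nbrCount G v (λ w → Lone w v))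
      ≡⟨ ∑-distrib-+ singles (λ v → nbrCount G v (λ w → Lone w v)) ⟩
    ∑[ v < n ] singles v + ∑[ v < n ] nbrCount G v (λ w → Lone w v)
      ≡⟨ cong (∑[ v < n ] singles v +_) (∑-nbrCount-swap G (λ v w → Lone w v)) ⟩
    ∑[ v < n ] singles v + ∑[ w < n ] nbrCount G w (Lone w)
      ≡⟨ cong (∑[ v < n ] singles v +_) (sum-cong-≗ singles-as-nbrCount) ⟩
    ∑[ v < n ] singles v + ∑[ v < n ] singles v ∎
    where
      open ≡-Reasoning
      double : ∀ n p → n * (2 * p) ≡ n * p + n * p
      double = solve-∀

  ∑singles≤n*p : ∑[ v < n ] singles v ≤ n * p
  ∑singles≤n*p = subst (∑[ v < n ] singles v ≤_) (∑-const n p) (∑-mono-≤ singles≤p)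

  singles≡p : ∀ v → singles v ≡ p
  singles≡p = ∑-mono-≤-tight singles≤p
    (≤-reflexive (trans (∑-const n p) (sym (proj₁ (squeeze ∑singles≤n*p incidences)))))

  no-edge-lone-both-ways : ∀ {v w} → Edge G v w → Lone v w ∧ Lone w v ≡ false
  no-edge-lone-both-ways {v} {w} e =
    subst (λ b → b ∧ (Lone v w ∧ Lone w v) ≡ false) e (count-≡0 (sym (zero-both v)) w)
    where
      zero-both : ∀ v → 0 ≡ both-lone v
      zero-both = ∑-mono-≤-tight (λ _ → z≤n)
        (≤-reflexive (trans (proj₂ (squeeze ∑singles≤n*p incidences)) (sym (sum-replicate-zero n))))

  Lone-antisymmetric : ∀ {v w} → Edge G v w → Lone w v ≡ not (Lone v w)
  Lone-antisymmetric e = xor-from-∨-∧ (lone-end e) (no-edge-lone-both-ways e)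

  PartnerColour : Fin n → Fin (p + 2) → Bool
  PartnerColour v c = not (single v c) ∧ not (f v == c)

  partner-colours : ∀ v → count (PartnerColour v) ≡ 1
  partner-colours v = +-cancelˡ-≡ p _ _ (begin
    p + count (PartnerColour v)
      ≡⟨ cong₂ _+_ (singles≡p v) (count-cong (λ c → ∧-comm (other c) (not (single v c)))) ⟨
    singles v + count (λ c → other c ∧ not (single v c))
      ≡⟨ cong (_+ count (λ c → other c ∧ not (single v c))) (count-cong single-other) ⟨
    count (λ c → other c ∧ single v c) + count (λ c → other c ∧ not (single v c))
      ≡⟨ count-split other (single v) ⟨
    count other
      ≡⟨ other-colours v ⟩
    suc p
      ≡⟨ +-comm 1 p ⟩
    p + 1 ∎)
    where
      open ≡-Reasoning
      other : Fin (p + 2) → Bool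
      other c = not (f v == c)
      single-other : ∀ c → other c ∧ single v c ≡ single v c
      single-other c with f v ≟ c
      ... | yes refl = cong isOne (sym (d-own v))
      ... | no _     = refl

  -- Opaque: unfolding the witness search makes type checking the lemmas below very slow.
  opaque
    partner : Fin n → Fin (p + 2)
    partner v = proj₁ (count-witness {P = PartnerColour v} (≤-reflexive (sym (partner-colours v))))

    partner-is-partner : ∀ v → PartnerColour v (partner v) ≡ true
    partner-is-partner v = proj₂ (count-witness {P = PartnerColour v} (≤-reflexive (sym (partner-colours v))))

  partner-unique : ∀ {v c} → PartnerColour v c ≡ true → c ≡ partner v
  partner-unique {v} h = count-≡1-unique {P = PartnerColour v} (partner-colours v) h (partner-is-partner v)

  partner≢own : ∀ v → partner v ≢ f v
  partner≢own v = not-==⇒≢ (proj₂ (∧≡true⇒ {not (single v (partner v))} (partner-is-partner v))) ∘ sym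

  d≡1-elsewhere : ∀ {v c} → c ≢ f v → c ≢ partner v → d v c ≡ 1
  d≡1-elsewhere {v} {c} c≢own c≢partner with d v c ℕ.≟ 1
  ... | yes d≡1 = d≡1
  ... | no  d≢1 = ⊥-elim (c≢partner (partner-unique
        (cong₂ (λ a b → not a ∧ not b) (≢1⇒isOne-false d≢1) (≢⇒==-false (c≢own ∘ sym)))))

  d-partner : ∀ v → d v (partner v) ≡ p
  d-partner v = +-cancelˡ-≡ p _ _ (begin
    p + d v (partner v)
      ≡⟨ cong₂ _+_ (singles≡p v) one-partner ⟨
    singles v + count (PartnerColour v) * d v (partner v)
      ≡⟨ cong₂ _+_ (sym (count-≡-∑ (single v)))
                   (∑-𝟙-* {P = PartnerColour v} {g = d v} (λ c → cong (d v) ∘ partner-unique)) ⟨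
    ∑[ c < p + 2 ] 𝟙 (single v c) + ∑[ c < p + 2 ] (𝟙 (PartnerColour v c) * d v c)
      ≡⟨ ∑-distrib-+ (𝟙 ∘ single v) (λ c → 𝟙 (PartnerColour v c) * d v c) ⟨
    ∑[ c < p + 2 ] (𝟙 (single v c) + 𝟙 (PartnerColour v c) * d v c)
      ≡⟨ sum-cong-≗ (λ c → isOne-decompose (d v c) (not (f v == c)) (own-colour c)) ⟨
    ∑[ c < p + 2 ] d v c
      ≡⟨ ∑-d v ⟩
    2 * p
      ≡⟨ cong (p +_) (+-identityʳ p) ⟩
    p + p ∎)
    where
      open ≡-Reasoning
      one-partner : count (PartnerColour v) * d v (partner v) ≡ d v (partner v)
      one-partner = trans (cong (_* d v (partner v)) (partner-colours v)) (+-identityʳ _)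
      own-colour : ∀ c → not (f v == c) ≡ false → d v c ≡ 0
      own-colour c own with f v ≟ c
      ... | yes refl = d-own v
      ... | no _     with () ← own

  labelling : Labelling p n
  labelling = (λ v → f v , partner v) , (λ v → partner≢own v ∘ sym)

  union-count : ∀ v → nbrCount G v (inUnion labelling (f v) (partner v)) ≡ p
  union-count v = trans (nbrCount-cong G pointwise) (d-partner v)
    where
      pointwise : ∀ w → Edge G v w → inUnion labelling (f v) (partner v) w ≡ (f w == partner v)
      pointwise w e with f w ≟ partner v
      ... | no _       = refl
      ... | yes fw≡pv = cong₂ (λ a b → not a ∧ not b) (≢⇒==-false pw≢fv) (≢⇒==-false pw≢pv)
        where
          pw≢pv : partner w ≢ partner v
          pw≢pv pw≡pv = partner≢own w (trans pw≡pv (sym fw≡pv))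
          w-not-lone : Lone v w ≡ false
          w-not-lone = trans (cong isOne (trans (cong (d v) fw≡pv) (d-partner v))) (≢1⇒isOne-false p≢1)
          d-w-own≡1 : d w (f v) ≡ 1
          d-w-own≡1 = isOne⇒≡1 (trans (Lone-antisymmetric e) (cong not w-not-lone))
          pw≢fv : partner w ≢ f v
          pw≢fv pw≡fv = p≢1 (trans (sym (d-partner w)) (trans (cong (d w) pw≡fv) d-w-own≡1))

  part-count : ∀ v k → k ≢ f v → k ≢ partner v → nbrCount G v (inPart labelling k (f v)) ≡ 1
  part-count v k k≢own k≢partner = trans (nbrCount-cong G pointwise) (d≡1-elsewhere k≢own k≢partner)
    where
      pointwise : ∀ w → Edge G v w → inPart labelling k (f v) w ≡ (f w == k)
      pointwise w e with f w ≟ k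
      ... | no _     = refl
      ... | yes fw≡k = dec-true (partner w ≟ f v) (sym (partner-unique own-is-partner))
        where
          v-not-lone : Lone w v ≡ false
          v-not-lone = trans (Lone-antisymmetric e)
            (cong (not ∘ isOne) (trans (cong (d v) fw≡k) (d≡1-elsewhere k≢own k≢partner)))
          own-is-partner : PartnerColour w (f v) ≡ true
          own-is-partner = cong₂ (λ a b → not a ∧ not b) v-not-lone (≢⇒==-false (proper w v (Edge-sym G e)))

  good-labelling : GoodPartition G labelling
  good-labelling i j _ v v∈Vij with ∧≡true⇒ v∈Vij
  ... | fv==i , pv==j with ==⇒≡ {x = f v} {i} fv==i | ==⇒≡ {x = partner v} {j} pv==j
  ...   | refl | refl = union-count v , part-count v

module StarColouringFromPartition {p n : ℕ} (G : Graph n) (regular : Regular G (2 * p))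
  (P : Labelling p n) (good : GoodPartition G P) where

  colour second : Fin n → Fin (p + 2)
  colour v = proj₁ (proj₁ P v)
  second v = proj₂ (proj₁ P v)

  colour≢second : ∀ v → colour v ≢ second v
  colour≢second = proj₂ P

  own-part : ∀ v → inPart P (colour v) (second v) v ≡ true
  own-part v rewrite ==-refl (colour v) = ==-refl (second v)

  good-at : ∀ v → nbrCount G v (inUnion P (colour v) (second v)) ≡ p ×
    (∀ k → k ≢ colour v → k ≢ second v → nbrCount G v (inPart P k (colour v)) ≡ 1)
  good-at v = good (colour v) (second v) (colour≢second v) v (own-part v)

  module Neighbours (v : Fin n) where

    i j : Fin (p + 2)
    i = colour v
    j = second v

    -- With v ∈ V_i^j, these are ⋃_{k∉{i,j}} V_j^k and ⋃_{k∉{i,j}} V_k^i.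
    U B : Fin n → Bool
    U = inUnion P i j
    B w = (second w == i) ∧ not (colour w == j)

    U∧B-empty : nbrCount G v (λ w → U w ∧ B w) ≡ 0
    U∧B-empty = trans (count-cong (λ w → trans (cong (adj G v w ∧_) (disjoint w)) (∧-zeroʳ (adj G v w))))
                      (count-false {n})
      where
        disjoint : ∀ w → U w ∧ B w ≡ false
        disjoint w with colour w == j
        ... | true  = trans (cong (second∉ij ∧_) (∧-zeroʳ (second w == i))) (∧-zeroʳ second∉ij)
          where second∉ij = not (second w == i) ∧ not (second w == j)
        ... | false = refl

    p≤nbrCount-B : p ≤ nbrCount G v B
    p≤nbrCount-B = begin
      p
        ≡⟨ +-cancelˡ-≡ 2 _ _ (trans (count-others₂ (colour≢second v)) (+-comm p 2)) ⟨
      count (λ k → not (i == k ∨ j == k))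
        ≡⟨ count-≡-∑ (λ k → not (i == k ∨ j == k)) ⟩
      ∑[ k < p + 2 ] 𝟙 (not (i == k ∨ j == k))
        ≤⟨ ∑-mono-≤ fibre ⟩
      ∑[ k < p + 2 ] nbrCount G v (λ w → B w ∧ colour w == k)
        ≡⟨ nbrCount-fibres G v B colour ⟨
      nbrCount G v B ∎
      where
        open ≤-Reasoning
        fibre : ∀ k → 𝟙 (not (i == k ∨ j == k)) ≤ nbrCount G v (λ w → B w ∧ colour w == k)
        fibre k with i ≟ k | j ≟ k
        ... | yes _  | _      = z≤n
        ... | no _   | yes _  = z≤n
        ... | no i≢k | no j≢k = ≤-reflexive (sym (trans (count-cong (λ w → cong (adj G v w ∧_) (in-part w)))
                                  (proj₂ (good-at v) k (i≢k ∘ sym) (j≢k ∘ sym))))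
          where
            in-part : ∀ w → B w ∧ colour w == k ≡ inPart P k i w
            in-part w with colour w ≟ k
            ... | yes refl rewrite ≢⇒==-false (j≢k ∘ sym) = trans (∧-identityʳ _) (∧-identityʳ _)
            ... | no _     = ∧-zeroʳ _

    degree≤nbrCount-U∨B : degree G v ≤ nbrCount G v (λ w → U w ∨ B w)
    degree≤nbrCount-U∨B = begin
      degree G v
        ≡⟨ trans (regular v) (cong (p +_) (+-identityʳ p)) ⟩
      p + p
        ≤⟨ +-monoʳ-≤ p p≤nbrCount-B ⟩
      p + nbrCount G v B
        ≡⟨ cong (_+ nbrCount G v B) (proj₁ (good-at v)) ⟨
      nbrCount G v U + nbrCount G v B
        ≡⟨ count-inclusion-exclusion (adj G v) U B ⟨
      nbrCount G v U∨B + nbrCount G v (λ w → U w ∧ B w)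
        ≡⟨ cong (nbrCount G v U∨B +_) U∧B-empty ⟩
      nbrCount G v U∨B + 0
        ≡⟨ +-identityʳ _ ⟩
      nbrCount G v U∨B ∎
      where
        open ≤-Reasoning
        U∨B : Fin n → Bool
        U∨B w = U w ∨ B w

    neighbour-in-U∨B : ∀ {w} → Edge G v w → U w ∨ B w ≡ true
    neighbour-in-U∨B {w} e = proj₂ (∧≡true⇒ (count-mono-tight
      (λ u h → cong (_∧ true) (proj₁ (∧≡true⇒ h))) degree≤nbrCount-U∨B w (cong (_∧ true) e)))

  neighbour-cases : ∀ {v w} → Edge G v w →
    (colour w ≡ second v × second w ≢ colour v) ⊎ (second w ≡ colour v × colour w ≢ second v)
  neighbour-cases {v} {w} e with ∨≡true⇒ (Neighbours.neighbour-in-U∨B v e)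
  ... | inj₁ w∈U with ∧≡true⇒ w∈U
  ...   | colour≡ , second∉ with ∧≡true⇒ second∉
  ...     | second≢ , _ = inj₁ (==⇒≡ colour≡ , not-==⇒≢ second≢)
  neighbour-cases {v} {w} e | inj₂ w∈B with ∧≡true⇒ w∈B
  ... | second≡ , colour≢ = inj₂ (==⇒≡ second≡ , not-==⇒≢ colour≢)

  proper : IsColouring G (p + 2) colour
  proper v w e v~w with neighbour-cases e
  ... | inj₁ (colour≡ , _) = colour≢second v (trans v~w colour≡)
  ... | inj₂ (second≡ , _) = colour≢second w (trans (sym v~w) (sym second≡))

  unique-neighbour : ∀ {v w w′} → Edge G v w → Edge G v w′ → colour w ≡ colour w′ → colour w ≢ second v → w ≡ w′
  unique-neighbour {v} {w} {w′} e e′ w~w′ colour≢ with neighbour-cases e | neighbour-cases e′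
  ... | inj₁ (colour≡ , _) | _                    = ⊥-elim (colour≢ colour≡)
  ... | inj₂ _             | inj₁ (colour≡ , _)   = ⊥-elim (colour≢ (trans w~w′ colour≡))
  ... | inj₂ (second≡ , _) | inj₂ (second≡′ , _) =
    count-≡1-unique (proj₂ (good-at v) (colour w) (proper v w e ∘ sym) colour≢)
      (in-part e refl second≡) (in-part e′ (sym w~w′) second≡′)
    where
      in-part : ∀ {u} → Edge G v u → colour u ≡ colour w → second u ≡ colour v →
        adj G v u ∧ inPart P (colour w) (colour v) u ≡ true
      in-part {u} e colour≡ second≡
        rewrite e | dec-true (colour u ≟ colour w) colour≡ | dec-true (second u ≟ colour v) second≡ = refl

  no-bicoloured-P4 : ¬ BicolouredP4 G colour
  no-bicoloured-P4 (a , b , c , d , (_ , a≢c , _ , _ , b≢d , _) , (ab , bc , cd) , (a~c , b~d))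
    with colour c ≟ second b
  ... | no c≁b = a≢c (unique-neighbour (Edge-sym G ab) bc a~c (c≁b ∘ trans (sym a~c)))
  ... | yes c∼b with neighbour-cases bc
  ...   | inj₂ (_ , c≁b)     = c≁b c∼b
  ...   | inj₁ (_ , second≢) = b≢d (unique-neighbour (Edge-sym G bc) cd b~d (second≢ ∘ sym))

  star-colouring : IsStarColouring G (p + 2) colour
  star-colouring = proper , no-bicoloured-P4

module PartitionSizes {p n : ℕ} (p≥2 : 2 ≤ p) (G : Graph n) (P : Labelling p n) (good : GoodPartition G P) where

  first second : Fin n → Fin (p + 2)
  first v  = proj₁ (proj₁ P v)
  second v = proj₂ (proj₁ P v)

  size : Fin (p + 2) → Fin (p + 2) → ℕ
  size = partSize P

  row column : Fin (p + 2) → ℕ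
  row j    = count (λ v → first v == j)
  column j = count (λ v → second v == j)

  size-diagonal : ∀ j → size j j ≡ 0
  size-diagonal j = trans (count-cong empty) (count-false {n})
    where
      empty : ∀ v → (first v == j) ∧ (second v == j) ≡ false
      empty v with first v ≟ j
      ... | yes refl = ≢⇒==-false (proj₂ P v ∘ sym)
      ... | no _     = refl

  row≡∑size : ∀ j → row j ≡ ∑[ k < p + 2 ] size j k
  row≡∑size j = count-fibres (λ v → first v == j) second

  column≡∑size : ∀ j → column j ≡ ∑[ i < p + 2 ] size i j
  column≡∑size j = trans (count-fibres (λ v → second v == j) first)
    (sum-cong-≗ (λ i → count-cong (λ v → ∧-comm (second v == j) (first v == i))))

  n≡∑row : n ≡ ∑[ j < p + 2 ] row j
  n≡∑row = trans (sym count-true) (count-fibres (λ _ → true) first)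

  union+size≡row : ∀ i j → count (inUnion P i j) + size j i ≡ row j
  union+size≡row i j = begin
    count (inUnion P i j) + size j i
      ≡⟨ +-comm _ (size j i) ⟩
    size j i + count (inUnion P i j)
      ≡⟨ cong (size j i +_) (count-cong pointwise) ⟨
    size j i + count (λ w → (first w == j) ∧ not (second w == i))
      ≡⟨ count-split (λ w → first w == j) (λ w → second w == i) ⟨
    row j ∎
    where
      open ≡-Reasoning
      pointwise : ∀ w → (first w == j) ∧ not (second w == i) ≡ inUnion P i j w
      pointwise w with first w ≟ j
      ... | yes refl rewrite ≢⇒==-false (proj₂ P w ∘ sym) = sym (∧-identityʳ _)
      ... | no _     = refl

  edge-count : ∀ {i j} → i ≢ j → p * size i j + size j i ≡ row j
  edge-count {i} {j} i≢j = begin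
    p * size i j + size j i
      ≡⟨ cong (_+ size j i) (*-comm p (size i j)) ⟩
    size i j * p + size j i
      ≡⟨ cong (_+ size j i) (double-counting G part⇒p union⇒1) ⟩
    count (inUnion P i j) * 1 + size j i
      ≡⟨ cong (_+ size j i) (*-identityʳ _) ⟩
    count (inUnion P i j) + size j i
      ≡⟨ union+size≡row i j ⟩
    row j ∎
    where
      open ≡-Reasoning
      part⇒p : ∀ v → inPart P i j v ≡ true → nbrCount G v (inUnion P i j) ≡ p
      part⇒p v v∈Vij = proj₁ (good i j i≢j v v∈Vij)
      union⇒1 : ∀ w → inUnion P i j w ≡ true → nbrCount G w (inPart P i j) ≡ 1
      union⇒1 w w∈U with ∧≡true⇒ w∈U
      ... | first≡j , second∉ij with ∧≡true⇒ second∉ij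
      ...   | second≢i , second≢j =
        proj₂ (good j (second w) (not-==⇒≢ second≢j ∘ sym) w w∈V) i i≢j (not-==⇒≢ second≢i ∘ sym)
        where
          w∈V : inPart P j (second w) w ≡ true
          w∈V = trans (cong (_∧ (second w == second w)) first≡j) (==-refl (second w))

  ∑-skew : ∀ (x y : Fin (p + 2) → ℕ) → ∑[ i < p + 2 ] (p * x i + y i) ≡ p * sum x + sum y
  ∑-skew x y = trans (∑-distrib-+ (λ i → p * x i) y) (cong (_+ sum y) (sym (*-distribˡ-sum p x)))

  skew-diagonal : ∀ j → p * size j j + size j j ≡ 0
  skew-diagonal j rewrite size-diagonal j = trans (+-identityʳ (p * 0)) (*-zeroʳ p)

  edge-counts-into : ∀ j → (p + 2) * row j ≡ row j + (p * column j + row j)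
  edge-counts-into j = begin
    (p + 2) * row j
      ≡⟨ cong₂ _+_ (skew-diagonal j) (∑-const (p + 2) (row j)) ⟨
    (p * size j j + size j j) + ∑[ i < p + 2 ] row j
      ≡⟨ ∑-cong-except {f = λ i → p * size i j + size j i} j (λ i → edge-count) ⟩
    row j + ∑[ i < p + 2 ] (p * size i j + size j i)
      ≡⟨ cong (row j +_) (∑-skew (λ i → size i j) (size j)) ⟩
    row j + (p * ∑[ i < p + 2 ] size i j + ∑[ i < p + 2 ] size j i)
      ≡⟨ cong₂ (λ x y → row j + (p * x + y)) (column≡∑size j) (row≡∑size j) ⟨
    row j + (p * column j + row j) ∎
    where open ≡-Reasoning

  edge-counts-out-of : ∀ j → n ≡ row j + (p * row j + column j)
  edge-counts-out-of j = begin
    n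
      ≡⟨ n≡∑row ⟩
    ∑[ i < p + 2 ] row i
      ≡⟨ cong (_+ ∑[ i < p + 2 ] row i) (skew-diagonal j) ⟨
    (p * size j j + size j j) + ∑[ i < p + 2 ] row i
      ≡⟨ ∑-cong-except {f = λ i → p * size j i + size i j} j (λ i i≢j → edge-count (i≢j ∘ sym)) ⟩
    row j + ∑[ i < p + 2 ] (p * size j i + size i j)
      ≡⟨ cong (row j +_) (∑-skew (size j) (λ i → size i j)) ⟩
    row j + (p * ∑[ i < p + 2 ] size j i + ∑[ i < p + 2 ] size i j)
      ≡⟨ cong₂ (λ x y → row j + (p * x + y)) (row≡∑size j) (column≡∑size j) ⟨
    row j + (p * row j + column j) ∎
    where open ≡-Reasoning

  column≡row : ∀ j → column j ≡ row j
  column≡row j = *-cancelˡ-≡ (column j) (row j) p {{>-nonZero (≤-trans (s≤s z≤n) p≥2)}}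
    (+-cancelʳ-≡ (row j + row j) _ _ (trans (regroupˡ p (column j) (row j))
      (trans (sym (edge-counts-into j)) (regroupʳ p (row j)))))
    where
      regroupˡ : ∀ p x y → p * x + (y + y) ≡ y + (p * x + y)
      regroupˡ = solve-∀
      regroupʳ : ∀ p x → (p + 2) * x ≡ p * x + (x + x)
      regroupʳ = solve-∀

  n≡[p+2]*row : ∀ j → n ≡ (p + 2) * row j
  n≡[p+2]*row j = trans (edge-counts-out-of j)
    (trans (cong (λ t → row j + (p * row j + t)) (column≡row j)) (regroup p (row j)))
    where
      regroup : ∀ p x → x + (p * x + x) ≡ (p + 2) * x
      regroup = solve-∀

  row-constant : ∀ i j → row i ≡ row j
  row-constant i j = *-cancelˡ-≡ (row i) (row j) (p + 2) {{subst NonZero (+-comm 2 p) _}}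
    (trans (sym (n≡[p+2]*row i)) (n≡[p+2]*row j))

  size-symmetric : ∀ {i j} → i ≢ j → size i j ≡ size j i
  size-symmetric {i} {j} i≢j = skew-cancel p≥2 (size i j) (size j i)
    (trans (edge-count i≢j) (trans (row-constant j i) (sym (edge-count (i≢j ∘ sym)))))

  [p+1]*size≡row : ∀ {i j} → i ≢ j → (p + 1) * size i j ≡ row j
  [p+1]*size≡row {i} {j} i≢j =
    trans (split p (size i j)) (trans (cong (p * size i j +_) (size-symmetric i≢j)) (edge-count i≢j))
    where
      split : ∀ p x → (p + 1) * x ≡ p * x + x
      split = solve-∀

  size-constant : ∀ {i j i′ j′} → i ≢ j → i′ ≢ j′ → size i j ≡ size i′ j′
  size-constant {i} {j} {i′} {j′} i≢j i′≢j′ =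
    *-cancelˡ-≡ (size i j) (size i′ j′) (p + 1) {{subst NonZero (+-comm 1 p) _}}
      (trans ([p+1]*size≡row i≢j) (trans (row-constant j j′) (sym ([p+1]*size≡row i′≢j′))))

  vertex-count-divisible : (p + 1) * (p + 2) ∣ n
  vertex-count-divisible = divides (size c₀ c₁) (begin
    n
      ≡⟨ n≡[p+2]*row c₁ ⟩
    (p + 2) * row c₁
      ≡⟨ cong ((p + 2) *_) ([p+1]*size≡row c₀≢c₁) ⟨
    (p + 2) * ((p + 1) * size c₀ c₁)
      ≡⟨ regroup p (size c₀ c₁) ⟩
    size c₀ c₁ * ((p + 1) * (p + 2)) ∎)
    where
      open ≡-Reasoning
      c₀ c₁ : Fin (p + 2)
      c₀ = p ↑ʳ zero
      c₁ = p ↑ʳ suc zero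
      c₀≢c₁ : c₀ ≢ c₁
      c₀≢c₁ eq with () ← ↑ʳ-injective p zero (suc zero) eq
      regroup : ∀ p x → (p + 2) * ((p + 1) * x) ≡ x * ((p + 1) * (p + 2))
      regroup = solve-∀

theorem3 : ∀ (p n : ℕ) → 2 ≤ p → (G : Graph n) → Regular G (2 * p) →
    (StarColourable G (p + 2) ⇔ HasGoodPartition p G) ×
    (∀ (P : Labelling p n) → GoodPartition G P →
      (∀ (i j i′ j′ : Fin (p + 2)) → i ≢ j → i′ ≢ j′ →
        partSize P i j ≡ partSize P i′ j′) ×
      ((p + 1) * (p + 2) ∣ n))
theorem3 p n p≥2 G regular = mk⇔ partition-of star-colouring-of , sizes
  where
    partition-of : StarColourable G (p + 2) → HasGoodPartition p G
    partition-of (f , star) = labelling , good-labelling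
      where open PartitionFromStarColouring p≥2 G regular f star

    star-colouring-of : HasGoodPartition p G → StarColourable G (p + 2)
    star-colouring-of (P , good) = colour , star-colouring
      where open StarColouringFromPartition G regular P good

    sizes : ∀ (P : Labelling p n) → GoodPartition G P →
      (∀ (i j i′ j′ : Fin (p + 2)) → i ≢ j → i′ ≢ j′ → partSize P i j ≡ partSize P i′ j′) ×
      ((p + 1) * (p + 2) ∣ n)
    sizes P good = (λ _ _ _ _ → size-constant) , vertex-count-divisible
      where open PartitionSizes p≥2 G P good
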